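{- Let $\alpha,\beta$ be relatively prime positive integers. If $(b,a)$ is $n$-good with $s=s(n)>2$, then $a\le(\beta-1)g_s+\alpha b$.
   Context: For positive integers $a_1,a_2$, the $(\alpha,\beta)$-walk $w_k(a_1,a_2)$ is the sequence with $w_1=a_1$, $w_2=a_2$, $w_{k+2}=\alpha w_{k+1}+\beta w_k$ for $k\ge1$. For a positive integer $n$, $s(n;a_1,a_2)$ is the (largest) index $s$ with $w_s(a_1,a_2)=n$ ($-\infty$ if none), and $s(n)=\max_{a_1,a_2\ge1}s(n;a_1,a_2)$. A pair $(a_1,a_2)$ is $n$-good if $a_1,a_2\ge1$ and $s(n;a_1,a_2)=s(n)$. The sequence $g_k$ is defined by $g_1=1$, $g_2=\alpha$, $g_{k+2}=\alpha g_{k+1}+\beta g_k$ for $k\ge1$. -}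

module Defs where

open import Data.Nat using (ℕ; zero; suc; _+_; _*_; _∸_; _≤_)
open import Data.Product using (_×_; _,_; proj₁; proj₂)

-- pair (w_{k+1}, w_{k+2}) of the (α,β)-walk starting from (a₁,a₂)
walkPair : ℕ → ℕ → ℕ → ℕ → ℕ → ℕ × ℕ
walkPair α β a₁ a₂ zero = a₁ , a₂
walkPair α β a₁ a₂ (suc k) with walkPair α β a₁ a₂ k
... | x , y = y , α * y + β * x

-- w α β a₁ a₂ k = w_k(a₁,a₂) for k ≥ 1 (1-indexed, as in the paper);
-- the value at k = 0 is junk (equal to a₁) and is never used.
w : ℕ → ℕ → ℕ → ℕ → ℕ → ℕ
w α β a₁ a₂ k = proj₁ (walkPair α β a₁ a₂ (k ∸ 1))

g : ℕ → ℕ → ℕ → ℕ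
g α β k = w α β 1 α k

IsSMax : ℕ → ℕ → ℕ → ℕ → Set
IsSMax α β n s = ∀ (a₁ a₂ k : ℕ) → 1 ≤ a₁ → 1 ≤ a₂ → 1 ≤ k →
                 w α β a₁ a₂ k ≡ n → k ≤ s
  where open import Relation.Binary.PropositionalEquality using (_≡_)

-- (a₁,a₂) is n-good with s(n) = s :  a₁,a₂ ≥ 1, w_s(a₁,a₂) = n
-- (so s(n;a₁,a₂) ≥ s) and s is the maximum s(n) over all positive pairs.
GoodWith : ℕ → ℕ → ℕ → ℕ → ℕ → ℕ → Set
GoodWith α β n a₁ a₂ s =
  1 ≤ a₁ × 1 ≤ a₂ × 1 ≤ s × w α β a₁ a₂ s ≡ n × IsSMax α β n s
  where open import Relation.Binary.PropositionalEquality using (_≡_)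

-- Write the walk as w_k(x,y) = x β V_{k-1} + y V_k, where V (V_0 = 0, V_1 = 1) is the
-- Lucas sequence of the recurrence; then g_k = V_k, and since V_k is coprime to β,
-- every residue mod β is hit by j g_s with j < β. If a > (β-1) g_s + α b, write
-- a - α b = j g_s + β c with j < β and c ≥ 1; then the positive pair (c, b + j V_{s-1})
-- reaches w_s(b,a) = n at index s + 1, contradicting the maximality of s.
module Submission where

open import Defs
open import Data.Nat
  using (ℕ; zero; suc; _+_; _*_; _∸_; _%_; _/_; _≤_; _<_; s≤s; z<s; NonZero; >-nonZero)
open import Data.Nat.Properties
open import Data.Nat.Divisibility
open import Data.Nat.DivMod using (m≡m%n+[m/n]*n; m%n<n)
open import Data.Nat.Coprimality using (Coprime; coprime-Bézout; coprime-factors)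
open import Data.Nat.GCD using (module Bézout)
open import Data.Nat.Tactic.RingSolver using (solve-∀)
open import Data.Product using (_×_; _,_; proj₁; ∃; ∃₂)
open import Relation.Nullary using (contradiction)
open import Relation.Binary.PropositionalEquality

+-*-congruent⇒∣∸ : ∀ {β a b q r} → a + β * q ≡ b + β * r → a ≤ b → β ∣ b ∸ a
+-*-congruent⇒∣∸ {β} {a} {b} {q} {r} eq a≤b = ∣m+n∣m⇒∣n β∣βr+δ (m∣m*n r)
  where
  δ = b ∸ a
  βq≡δ+βr : β * q ≡ δ + β * r
  βq≡δ+βr = +-cancelˡ-≡ a _ _ (begin
    a + β * q       ≡⟨ eq ⟩
    b + β * r       ≡⟨ cong (_+ β * r) (m+[n∸m]≡n a≤b) ⟨
    a + δ + β * r   ≡⟨ +-assoc a δ (β * r) ⟩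
    a + (δ + β * r) ∎)
    where open ≡-Reasoning
  β∣βr+δ : β ∣ β * r + δ
  β∣βr+δ = subst (β ∣_) (trans βq≡δ+βr (+-comm δ (β * r))) (m∣m*n q)

coprime⇒invertible-mod : ∀ {G} β .{{_ : NonZero β}} → Coprime G β →
                         ∃ λ x → ∃₂ λ z y → x * G + β * z ≡ 1 + β * y
coprime⇒invertible-mod {G} β cop with coprime-Bézout cop
... | Bézout.+- x y 1+yβ≡xG = x , 0 , y , (begin
  x * G + β * 0 ≡⟨ cong (x * G +_) (*-zeroʳ β) ⟩
  x * G + 0     ≡⟨ +-identityʳ (x * G) ⟩
  x * G         ≡⟨ 1+yβ≡xG ⟨
  1 + y * β     ≡⟨ cong (1 +_) (*-comm y β) ⟩
  1 + β * y     ∎)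
  where open ≡-Reasoning
coprime⇒invertible-mod {G} (suc β′) cop | Bézout.-+ x y 1+xG≡yβ =
  -- multiply 1 + x G ≡ y β by β - 1 ≡ -1 (mod β)
  β′ * x , 1 , β′ * y , (begin
    β′ * x * G + suc β′ * 1  ≡⟨ expand β′ x G ⟩
    1 + β′ * (1 + x * G)     ≡⟨ cong (λ t → 1 + β′ * t) 1+xG≡yβ ⟩
    1 + β′ * (y * suc β′)    ≡⟨ regroup β′ y ⟩
    1 + suc β′ * (β′ * y)    ∎)
  where
  open ≡-Reasoning
  expand : ∀ β′ x G → β′ * x * G + suc β′ * 1 ≡ 1 + β′ * (1 + x * G)
  expand = solve-∀
  regroup : ∀ β′ y → 1 + β′ * (y * suc β′) ≡ 1 + suc β′ * (β′ * y)
  regroup = solve-∀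

coprime⇒residue-multiple : ∀ {G} β .{{_ : NonZero β}} → Coprime G β → ∀ D →
                   ∃ λ j → j < β × ∃₂ λ q r → j * G + β * q ≡ D + β * r
coprime⇒residue-multiple {G} β cop D with coprime⇒invertible-mod β cop
... | x , z , y , xG+βz≡1+βy =
  j , m%n<n (D * x) β , q * G + D * z , D * y , (begin
    j * G + β * (q * G + D * z)     ≡⟨ regroup j q G β D z ⟩
    (j + q * β) * G + D * (β * z)   ≡⟨ cong (λ t → t * G + D * (β * z)) (m≡m%n+[m/n]*n (D * x) β) ⟨
    D * x * G + D * (β * z)         ≡⟨ factor D x G β z ⟩
    D * (x * G + β * z)             ≡⟨ cong (D *_) xG+βz≡1+βy ⟩
    D * (1 + β * y)                 ≡⟨ expand D β y ⟩
    D + β * (D * y)                 ∎)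
  where
  open ≡-Reasoning
  j = (D * x) % β
  q = (D * x) / β
  regroup : ∀ j q G β D z → j * G + β * (q * G + D * z) ≡ (j + q * β) * G + D * (β * z)
  regroup = solve-∀
  factor : ∀ D x G β z → D * x * G + D * (β * z) ≡ D * (x * G + β * z)
  factor = solve-∀
  expand : ∀ D β y → D * (1 + β * y) ≡ D + β * (D * y)
  expand = solve-∀

+-*-congruent-<⇒∃-multiple : ∀ {β a b q r} → a + β * q ≡ b + β * r → a < b →
                             ∃ λ c → 0 < c × b ≡ a + β * c
+-*-congruent-<⇒∃-multiple {β} {a} {b} a+βq≡b+βr a<b
  with +-*-congruent⇒∣∸ a+βq≡b+βr (<⇒≤ a<b)
... | divides zero b∸a≡0 = contradiction b∸a≡0 (m>n⇒m∸n≢0 a<b)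
... | divides c@(suc _) b∸a≡cβ = c , z<s , (begin
  b           ≡⟨ m+[n∸m]≡n (<⇒≤ a<b) ⟨
  a + (b ∸ a) ≡⟨ cong (a +_) (trans b∸a≡cβ (*-comm c β)) ⟩
  a + β * c   ∎)
  where open ≡-Reasoning

coprime⇒representable : ∀ {G D} β .{{_ : NonZero β}} → Coprime G β → (β ∸ 1) * G < D →
                        ∃₂ λ j c → j < β × 0 < c × D ≡ j * G + β * c
coprime⇒representable {G} {D} β cop βG<D =
  let j , j<β , _ , _ , jG+βq≡D+βr = coprime⇒residue-multiple β cop D
      jG<D = ≤-<-trans (*-monoˡ-≤ G (∸-monoˡ-≤ 1 j<β)) βG<D
      c , 0<c , D≡jG+βc = +-*-congruent-<⇒∃-multiple {β} jG+βq≡D+βr jG<D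
  in  j , c , j<β , 0<c , D≡jG+βc

module Walk (α β : ℕ) where

  walk : ℕ → ℕ → ℕ → ℕ
  walk x y k = proj₁ (walkPair α β x y k)

  lucas : ℕ → ℕ
  lucas = walk 0 1

  walk-basis : ∀ x y k → walk x y (suc k) ≡ x * (β * lucas k) + y * lucas (suc k)
  walk-basis x y zero = base₀ x y β
    where
    base₀ : ∀ x y β → y ≡ x * (β * 0) + y * 1
    base₀ = solve-∀
  walk-basis x y (suc zero) = base₁ α β x y
    where
    base₁ : ∀ α β x y → α * y + β * x ≡ x * (β * 1) + y * (α * 1 + β * 0)
    base₁ = solve-∀
  walk-basis x y (suc (suc k)) = begin
    α * walk x y (suc (suc k)) + β * walk x y (suc k)
      ≡⟨ cong₂ (λ u v → α * u + β * v) (walk-basis x y (suc k)) (walk-basis x y k) ⟩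
    α * (x * (β * L₁) + y * L₂) + β * (x * (β * L₀) + y * L₁)
      ≡⟨ step α β x y L₀ L₁ L₂ ⟩
    x * (β * (α * L₁ + β * L₀)) + y * (α * L₂ + β * L₁) ∎
    where
    open ≡-Reasoning
    L₀ = lucas k
    L₁ = lucas (suc k)
    L₂ = lucas (suc (suc k))
    step : ∀ α β x y L₀ L₁ L₂ →
           α * (x * (β * L₁) + y * L₂) + β * (x * (β * L₀) + y * L₁)
           ≡ x * (β * (α * L₁ + β * L₀)) + y * (α * L₂ + β * L₁)
    step = solve-∀

  g≡lucas : ∀ k → g α β (suc k) ≡ lucas (suc k)
  g≡lucas zero = refl
  g≡lucas (suc k) = trans (walk-basis 1 α k) (swap β α (lucas k) (lucas (suc k)))
    where
    swap : ∀ β α L₀ L₁ → 1 * (β * L₀) + α * L₁ ≡ α * L₁ + β * L₀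
    swap = solve-∀

  lucas-coprime : Coprime α β → ∀ k → Coprime (lucas (suc k)) β
  lucas-coprime cop zero (d∣1 , _) = ∣1⇒≡1 d∣1
  lucas-coprime cop (suc k) {d} (d∣L₂ , d∣β) = lucas-coprime cop k (d∣L₁ , d∣β)
    where
    d∣αL₁ : d ∣ α * lucas (suc k)
    d∣αL₁ = ∣m+n∣m⇒∣n (subst (d ∣_) (+-comm (α * lucas (suc k)) _) d∣L₂)
                      (∣m⇒∣m*n (lucas k) d∣β)
    d∣L₁ : d ∣ lucas (suc k)
    d∣L₁ = coprime-factors cop (d∣αL₁ , ∣m⇒∣m*n (lucas (suc k)) d∣β)

  walk-lengthen : ∀ b c j k →
                  walk c (b + j * lucas (suc k)) (suc (suc k))
                  ≡ walk b (α * b + (j * lucas (suc (suc k)) + β * c)) (suc k)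
  walk-lengthen b c j k = begin
    walk c (b + j * L₁) (suc (suc k))                   ≡⟨ walk-basis c (b + j * L₁) (suc k) ⟩
    c * (β * L₁) + (b + j * L₁) * (α * L₁ + β * L₀)     ≡⟨ regroup α β b c j L₀ L₁ ⟩
    b * (β * L₀) + (α * b + (j * (α * L₁ + β * L₀) + β * c)) * L₁
                                                        ≡⟨ walk-basis b _ k ⟨
    walk b (α * b + (j * lucas (suc (suc k)) + β * c)) (suc k) ∎
    where
    open ≡-Reasoning
    L₀ = lucas k
    L₁ = lucas (suc k)
    regroup : ∀ α β b c j L₀ L₁ →
              c * (β * L₁) + (b + j * L₁) * (α * L₁ + β * L₀)
              ≡ b * (β * L₀) + (α * b + (j * (α * L₁ + β * L₀) + β * c)) * L₁
    regroup = solve-∀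

  unbounded⇒longer-walk : .{{_ : NonZero β}} → Coprime α β → ∀ {b a} k → 0 < b →
                          (β ∸ 1) * lucas (suc (suc k)) + α * b < a →
                          ∃₂ λ c y → 0 < c × 0 < y × walk c y (suc (suc k)) ≡ walk b a (suc k)
  unbounded⇒longer-walk cop {b} {a} k 0<b bound<a =
    let j , c , _ , 0<c , D≡jG+βc = coprime⇒representable β (lucas-coprime cop (suc k)) βG<D
    in  c , b + j * lucas (suc k) , 0<c , ≤-trans 0<b (m≤m+n b _) , reaches j c D≡jG+βc
    where
    G = lucas (suc (suc k))
    αb≤a : α * b ≤ a
    αb≤a = ≤-trans (m≤n+m (α * b) _) (<⇒≤ bound<a)
    βG<D : (β ∸ 1) * G < a ∸ α * b
    βG<D = subst (_< a ∸ α * b) (m+n∸n≡m _ (α * b)) (∸-monoˡ-< bound<a (m≤n+m (α * b) _))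
    reaches : ∀ j c → a ∸ α * b ≡ j * G + β * c →
              walk c (b + j * lucas (suc k)) (suc (suc k)) ≡ walk b a (suc k)
    reaches j c D≡jG+βc = begin
      walk c (b + j * lucas (suc k)) (suc (suc k))   ≡⟨ walk-lengthen b c j k ⟩
      walk b (α * b + (j * G + β * c)) (suc k)       ≡⟨ cong (λ t → walk b (α * b + t) (suc k)) D≡jG+βc ⟨
      walk b (α * b + (a ∸ α * b)) (suc k)           ≡⟨ cong (λ t → walk b t (suc k)) (m+[n∸m]≡n αb≤a) ⟩
      walk b a (suc k)                               ∎
      where open ≡-Reasoning

lemma5 : (α β : ℕ) → 1 ≤ α → 1 ≤ β → Coprime α β →
         (n b a s : ℕ) → GoodWith α β n b a s → 2 < s →
         a ≤ (β ∸ 1) * g α β s + α * b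
lemma5 α β _ 0<β cop n b a (suc (suc k)) (0<b , _ , _ , reach , maximal) _ =
  ≮⇒≥ λ bound<a →
    let c , y , 0<c , 0<y , reach′ = unbounded⇒longer-walk {{>-nonZero 0<β}} cop k 0<b
          (subst (λ G → (β ∸ 1) * G + α * b < a) (g≡lucas (suc k)) bound<a)
    in  n≮n _ (maximal c y (3 + k) 0<c 0<y z<s (trans reach′ reach))
  where open Walk α β
lemma5 α β _ _ _ n b a (suc zero) _ (s≤s ())
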